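{- Let $G$ be a minimally non-$2$-divisible graph, $X$ a clique of $G$, and $V(G)\setminus X=V_1\cup V_2$ a partition into nonempty sets with no edges between $V_1$ and $V_2$. Let $G_i=G[X\cup V_i]$ for $i=1,2$. Then for any $2$-division $(A_i,B_i)$ of $G_i$ ($i=1,2$), we have $X\setminus\big((A_1\cap A_2)\cup(B_1\cap B_2)\big)\ne\emptyset$.
   Context: A $2$-division of a graph $H$ is a partition $(A,B)$ of $V(H)$ with $\omega(H[A])<\omega(H)$ and $\omega(H[B])<\omega(H)$. $H$ is $2$-divisible if each of its induced subgraphs with at least one edge has a $2$-division. $G$ is minimally non-$2$-divisible if $G$ is not $2$-divisible but every proper induced subgraph of $G$ is $2$-divisible. -}

module Defs where

open import Data.Nat using (ℕ; _<_; _≤_)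
open import Data.Fin using (Fin)
open import Data.Fin.Subset using (Subset; _∈_; _∉_; _⊆_; ∣_∣)
open import Data.Product using (Σ; ∃; ∃-syntax; _×_; _,_)
open import Data.Sum using (_⊎_)
open import Relation.Nullary using (¬_)
open import Relation.Binary.PropositionalEquality using (_≡_; _≢_)

record Graph (n : ℕ) : Set₁ where
  field
    Adj       : Fin n → Fin n → Set
    Adj-sym   : ∀ {x y} → Adj x y → Adj y x
    Adj-irrefl : ∀ {x} → ¬ Adj x x
open Graph public

module _ {n : ℕ} (G : Graph n) where

  IsClique : Subset n → Set
  IsClique K = ∀ {x y} → x ∈ K → y ∈ K → x ≢ y → Adj G x y

  IsCliqueIn : Subset n → Subset n → Set
  IsCliqueIn S K = K ⊆ S × IsClique K

  CliqueNumber : Subset n → ℕ → Set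
  CliqueNumber S k =
    (∃[ K ] (IsCliqueIn S K × ∣ K ∣ ≡ k)) ×
    (∀ K → IsCliqueIn S K → ∣ K ∣ ≤ k)

  ωLess : Subset n → Subset n → Set
  ωLess A S = ∃[ a ] ∃[ s ] (CliqueNumber A a × CliqueNumber S s × a < s)

  IsPartition : Subset n → Subset n → Subset n → Set
  IsPartition S A B =
    (∀ x → x ∈ S → x ∈ A ⊎ x ∈ B) ×
    A ⊆ S × B ⊆ S ×
    (∀ x → x ∈ A → x ∉ B)

  TwoDivision : Subset n → Subset n → Subset n → Set
  TwoDivision S A B = IsPartition S A B × ωLess A S × ωLess B S

  HasEdge : Subset n → Set
  HasEdge S = ∃[ x ] ∃[ y ] (x ∈ S × y ∈ S × Adj G x y)

  TwoDivisible : Subset n → Set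
  TwoDivisible S = ∀ T → T ⊆ S → HasEdge T → ∃[ A ] ∃[ B ] TwoDivision T A B

  Full : Subset n → Set
  Full S = ∀ x → x ∈ S

  MinimallyNon2Divisible : Set
  MinimallyNon2Divisible =
    (∀ S → Full S → ¬ TwoDivisible S) ×
    (∀ S → ¬ Full S → TwoDivisible S)

{-# OPTIONS --safe #-}
-- If every vertex of X lay in A₁ ∩ A₂ or in B₁ ∩ B₂, then (A₁ ∪ A₂ , B₁ ∪ B₂)
-- would be a partition of V(G) restricting to (Aᵢ , Bᵢ) on V(Gᵢ). As there are
-- no edges between V₁ and V₂, every clique of G lies in G₁ or in G₂, so the
-- clique number of G, and of each glued part, is the maximum of the values on
-- the two sides; hence the glued partition is a 2-division of G. Together with
-- the 2-divisions of the proper induced subgraphs this makes G 2-divisible.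
module Submission where

open import Defs
open import Data.Nat using (ℕ; _≤_; _⊔_)
open import Data.Nat.Properties using (⊔-sel; m≤n⇒m≤n⊔o; m≤n⇒m≤o⊔n; ⊔-mono-<)
open import Data.Fin.Subset using (Subset; _∈_; _∉_; _⊆_; _∪_; ⊤; ∣_∣)
open import Data.Fin.Subset.Properties using (_∈?_; ∈⊤; ⊆⊤; ⊆-antisym; x∈p∪q⁻; x∈p∪q⁺; p⊆p∪q; q⊆p∪q)
open import Data.Fin.Properties using (any?; all?)
open import Data.Product using (∃-syntax; _×_; _,_; proj₁)
import Data.Product as Product
open import Data.Sum using (_⊎_; inj₁; inj₂)
import Data.Sum as Sum
open import Data.Empty using (⊥-elim)
open import Function using (id; _∘_)
open import Relation.Nullary using (¬_; yes; no)
open import Relation.Nullary.Decidable using (_×-dec_; ¬?)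
open import Relation.Binary.PropositionalEquality using (_≡_; refl; sym; trans; subst)

module _ {n : ℕ} where

  disjoint-sym : {A B : Subset n} → (∀ x → x ∈ A → x ∉ B) → (∀ x → x ∈ B → x ∉ A)
  disjoint-sym A∩B=∅ x x∈B x∈A = A∩B=∅ x x∈A x∈B

  AgreeOn : (X A₁ B₁ A₂ B₂ : Subset n) → Set
  AgreeOn X A₁ B₁ A₂ B₂ = ∀ {x} → x ∈ X → (x ∈ A₁ × x ∈ A₂) ⊎ (x ∈ B₁ × x ∈ B₂)

  agreeOn-sym : ∀ {X A₁ B₁ A₂ B₂} → AgreeOn X A₁ B₁ A₂ B₂ → AgreeOn X A₂ B₂ A₁ B₁
  agreeOn-sym agree = Sum.map Product.swap Product.swap ∘ agree

  agreeOn-swap : ∀ {X A₁ B₁ A₂ B₂} → AgreeOn X A₁ B₁ A₂ B₂ → AgreeOn X B₁ A₁ B₂ A₂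
  agreeOn-swap agree = Sum.swap ∘ agree

  agreeOn-or-disagree : (X A₁ B₁ A₂ B₂ : Subset n) →
    AgreeOn X A₁ B₁ A₂ B₂ ⊎ ∃[ x ] (x ∈ X × ¬ (x ∈ A₁ × x ∈ A₂) × ¬ (x ∈ B₁ × x ∈ B₂))
  agreeOn-or-disagree X A₁ B₁ A₂ B₂
    with any? (λ x → (x ∈? X) ×-dec ¬? ((x ∈? A₁) ×-dec (x ∈? A₂)) ×-dec ¬? ((x ∈? B₁) ×-dec (x ∈? B₂)))
  ... | yes disagreement = inj₂ disagreement
  ... | no no-disagreement = inj₁ agree
    where
    agree : AgreeOn X A₁ B₁ A₂ B₂
    agree {x} x∈X with (x ∈? A₁) ×-dec (x ∈? A₂) | (x ∈? B₁) ×-dec (x ∈? B₂)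
    ... | yes x∈A₁∩A₂ | _            = inj₁ x∈A₁∩A₂
    ... | no _        | yes x∈B₁∩B₂ = inj₂ x∈B₁∩B₂
    ... | no x∉A₁∩A₂  | no x∉B₁∩B₂  = ⊥-elim (no-disagreement (x , x∈X , x∉A₁∩A₂ , x∉B₁∩B₂))

  agreeOn-transfer : ∀ {X P Q C₁ D₁ C₂ D₂} → (∀ {x} → x ∈ P → x ∈ Q → x ∈ X) →
    C₂ ⊆ Q → (∀ x → x ∈ C₂ → x ∉ D₂) → AgreeOn X C₁ D₁ C₂ D₂ →
    ∀ {x} → x ∈ C₂ → x ∈ P → x ∈ C₁
  agreeOn-transfer P∩Q⊆X C₂⊆Q C₂∩D₂=∅ agree {x} x∈C₂ x∈P with agree (P∩Q⊆X x∈P (C₂⊆Q x∈C₂))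
  ... | inj₁ (x∈C₁ , _) = x∈C₁
  ... | inj₂ (_ , x∈D₂) = ⊥-elim (C₂∩D₂=∅ x x∈C₂ x∈D₂)

module _ {n : ℕ} (G : Graph n) where

  CoversCliques : Subset n → Subset n → Subset n → Set
  CoversCliques C C₁ C₂ =
    C₁ ⊆ C × C₂ ⊆ C × (∀ K → IsCliqueIn G C K → K ⊆ C₁ ⊎ K ⊆ C₂)

  cliqueNumber-⊔ : ∀ {C C₁ C₂ c₁ c₂} → CoversCliques C C₁ C₂ →
    CliqueNumber G C₁ c₁ → CliqueNumber G C₂ c₂ → CliqueNumber G C (c₁ ⊔ c₂)
  cliqueNumber-⊔ {C} {c₁ = c₁} {c₂} (C₁⊆C , C₂⊆C , covers)
    ((K₁ , (K₁⊆C₁ , K₁-clique) , ∣K₁∣≡c₁) , max₁)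
    ((K₂ , (K₂⊆C₂ , K₂-clique) , ∣K₂∣≡c₂) , max₂) = largest , bounded
    where
    largest : ∃[ K ] (IsCliqueIn G C K × ∣ K ∣ ≡ c₁ ⊔ c₂)
    largest with ⊔-sel c₁ c₂
    ... | inj₁ ⊔≡c₁ = K₁ , (C₁⊆C ∘ K₁⊆C₁ , K₁-clique) , trans ∣K₁∣≡c₁ (sym ⊔≡c₁)
    ... | inj₂ ⊔≡c₂ = K₂ , (C₂⊆C ∘ K₂⊆C₂ , K₂-clique) , trans ∣K₂∣≡c₂ (sym ⊔≡c₂)
    bounded : ∀ K → IsCliqueIn G C K → ∣ K ∣ ≤ c₁ ⊔ c₂
    bounded K K-in-C@(_ , K-clique) with covers K K-in-C
    ... | inj₁ K⊆C₁ = m≤n⇒m≤n⊔o c₂ (max₁ K (K⊆C₁ , K-clique))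
    ... | inj₂ K⊆C₂ = m≤n⇒m≤o⊔n c₁ (max₂ K (K⊆C₂ , K-clique))

  ωLess-⊔ : ∀ {C C₁ C₂ S S₁ S₂} → CoversCliques C C₁ C₂ → CoversCliques S S₁ S₂ →
    ωLess G C₁ S₁ → ωLess G C₂ S₂ → ωLess G C S
  ωLess-⊔ C-covered S-covered (a₁ , s₁ , ωC₁ , ωS₁ , a₁<s₁) (a₂ , s₂ , ωC₂ , ωS₂ , a₂<s₂) =
    a₁ ⊔ a₂ , s₁ ⊔ s₂ ,
    cliqueNumber-⊔ C-covered ωC₁ ωC₂ , cliqueNumber-⊔ S-covered ωS₁ ωS₂ ,
    ⊔-mono-< a₁<s₁ a₂<s₂

  ¬twoDivision-⊤ : MinimallyNon2Divisible G → ∀ {A B} → ¬ TwoDivision G ⊤ A B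
  ¬twoDivision-⊤ (not-divisible , proper-divisible) {A} {B} division =
    not-divisible ⊤ (λ _ → ∈⊤) divisible
    where
    divisible : TwoDivisible G ⊤
    divisible T _ has-edge with all? (_∈? T)
    ... | yes full = A , B , subst (λ S → TwoDivision G S A B) (⊆-antisym (λ {x} _ → full x) ⊆⊤) division
    ... | no not-full = proper-divisible T not-full T id has-edge

module Separation {n : ℕ} (G : Graph n) (X V₁ V₂ : Subset n)
  (outside-X : ∀ v → v ∉ X → v ∈ V₁ ⊎ v ∈ V₂)
  (V₁∩V₂=∅ : ∀ v → v ∈ V₁ → v ∉ V₂)
  (no-edge : ∀ u v → u ∈ V₁ → v ∈ V₂ → ¬ Adj G u v) where

  position : ∀ x → x ∈ X ⊎ x ∈ V₁ ⊎ x ∈ V₂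
  position x with x ∈? X
  ... | yes x∈X = inj₁ x∈X
  ... | no x∉X = inj₂ (outside-X x x∉X)

  sides-meet-in-X : ∀ {x} → x ∈ X ∪ V₁ → x ∈ X ∪ V₂ → x ∈ X
  sides-meet-in-X {x} x∈G₁ x∈G₂ with x∈p∪q⁻ X V₁ x∈G₁ | x∈p∪q⁻ X V₂ x∈G₂
  ... | inj₁ x∈X | _        = x∈X
  ... | inj₂ _   | inj₁ x∈X = x∈X
  ... | inj₂ x∈V₁ | inj₂ x∈V₂ = ⊥-elim (V₁∩V₂=∅ x x∈V₁ x∈V₂)

  clique-⊆-side : ∀ K → IsClique G K → K ⊆ X ∪ V₁ ⊎ K ⊆ X ∪ V₂
  clique-⊆-side K K-clique with any? (λ u → (u ∈? K) ×-dec (u ∈? V₁))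
  ... | yes (u , u∈K , u∈V₁) = inj₁ λ {x} → ⊆G₁ x
    where
    ⊆G₁ : ∀ x → x ∈ K → x ∈ X ∪ V₁
    ⊆G₁ x x∈K with position x
    ... | inj₁ x∈X        = x∈p∪q⁺ (inj₁ x∈X)
    ... | inj₂ (inj₁ x∈V₁) = x∈p∪q⁺ (inj₂ x∈V₁)
    ... | inj₂ (inj₂ x∈V₂) =
      ⊥-elim (no-edge u x u∈V₁ x∈V₂ (K-clique u∈K x∈K λ { refl → V₁∩V₂=∅ u u∈V₁ x∈V₂ }))
  ... | no K∩V₁=∅ = inj₂ λ {x} → ⊆G₂ x
    where
    ⊆G₂ : ∀ x → x ∈ K → x ∈ X ∪ V₂
    ⊆G₂ x x∈K with position x
    ... | inj₁ x∈X        = x∈p∪q⁺ (inj₁ x∈X)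
    ... | inj₂ (inj₁ x∈V₁) = ⊥-elim (K∩V₁=∅ (x , x∈K , x∈V₁))
    ... | inj₂ (inj₂ x∈V₂) = x∈p∪q⁺ (inj₂ x∈V₂)

  coversCliques-⊤ : CoversCliques G ⊤ (X ∪ V₁) (X ∪ V₂)
  coversCliques-⊤ = ⊆⊤ , ⊆⊤ , λ K (_ , K-clique) → clique-⊆-side K K-clique

  coversCliques-∪ : ∀ {C₁ C₂} →
    (∀ {x} → x ∈ C₂ → x ∈ X ∪ V₁ → x ∈ C₁) → (∀ {x} → x ∈ C₁ → x ∈ X ∪ V₂ → x ∈ C₂) →
    CoversCliques G (C₁ ∪ C₂) C₁ C₂
  coversCliques-∪ {C₁} {C₂} C₂→C₁ C₁→C₂ =
    p⊆p∪q C₂ , q⊆p∪q C₁ C₂ ,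
    λ K (K⊆C , K-clique) → Sum.map (restrict₁ K⊆C) (restrict₂ K⊆C) (clique-⊆-side K K-clique)
    where
    restrict₁ : ∀ {K} → K ⊆ C₁ ∪ C₂ → K ⊆ X ∪ V₁ → K ⊆ C₁
    restrict₁ K⊆C K⊆G₁ x∈K = Sum.[ id , (λ x∈C₂ → C₂→C₁ x∈C₂ (K⊆G₁ x∈K)) ]′ (x∈p∪q⁻ C₁ C₂ (K⊆C x∈K))
    restrict₂ : ∀ {K} → K ⊆ C₁ ∪ C₂ → K ⊆ X ∪ V₂ → K ⊆ C₂
    restrict₂ K⊆C K⊆G₂ x∈K = Sum.[ (λ x∈C₁ → C₁→C₂ x∈C₁ (K⊆G₂ x∈K)) , id ]′ (x∈p∪q⁻ C₁ C₂ (K⊆C x∈K))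

  ωLess-glued : ∀ {C₁ D₁ C₂ D₂} → C₁ ⊆ X ∪ V₁ → C₂ ⊆ X ∪ V₂ →
    (∀ x → x ∈ C₁ → x ∉ D₁) → (∀ x → x ∈ C₂ → x ∉ D₂) → AgreeOn X C₁ D₁ C₂ D₂ →
    ωLess G C₁ (X ∪ V₁) → ωLess G C₂ (X ∪ V₂) → ωLess G (C₁ ∪ C₂) ⊤
  ωLess-glued {C₁ = C₁} {C₂ = C₂} C₁⊆G₁ C₂⊆G₂ C₁∩D₁=∅ C₂∩D₂=∅ agree =
    ωLess-⊔ G (coversCliques-∪ C₂→C₁ C₁→C₂) coversCliques-⊤
    where
    C₂→C₁ : ∀ {x} → x ∈ C₂ → x ∈ X ∪ V₁ → x ∈ C₁
    C₂→C₁ = agreeOn-transfer sides-meet-in-X C₂⊆G₂ C₂∩D₂=∅ agree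
    C₁→C₂ : ∀ {x} → x ∈ C₁ → x ∈ X ∪ V₂ → x ∈ C₂
    C₁→C₂ = agreeOn-transfer (λ x∈G₂ x∈G₁ → sides-meet-in-X x∈G₁ x∈G₂) C₁⊆G₁ C₁∩D₁=∅ (agreeOn-sym agree)

  isPartition-glued : ∀ {A₁ B₁ A₂ B₂} →
    IsPartition G (X ∪ V₁) A₁ B₁ → IsPartition G (X ∪ V₂) A₂ B₂ → AgreeOn X A₁ B₁ A₂ B₂ →
    IsPartition G ⊤ (A₁ ∪ A₂) (B₁ ∪ B₂)
  isPartition-glued {A₁} {B₁} {A₂} {B₂}
    (cover₁ , A₁⊆G₁ , B₁⊆G₁ , A₁∩B₁=∅) (cover₂ , A₂⊆G₂ , B₂⊆G₂ , A₂∩B₂=∅) agree =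
    cover , ⊆⊤ , ⊆⊤ , disjoint
    where
    A₂→A₁ : ∀ {x} → x ∈ A₂ → x ∈ X ∪ V₁ → x ∈ A₁
    A₂→A₁ = agreeOn-transfer sides-meet-in-X A₂⊆G₂ A₂∩B₂=∅ agree
    B₂→B₁ : ∀ {x} → x ∈ B₂ → x ∈ X ∪ V₁ → x ∈ B₁
    B₂→B₁ = agreeOn-transfer sides-meet-in-X B₂⊆G₂ (disjoint-sym A₂∩B₂=∅) (agreeOn-swap agree)
    cover : ∀ x → x ∈ ⊤ → x ∈ A₁ ∪ A₂ ⊎ x ∈ B₁ ∪ B₂
    cover x _ with position x
    ... | inj₁ x∈X = Sum.map (p⊆p∪q A₂ ∘ proj₁) (p⊆p∪q B₂ ∘ proj₁) (agree x∈X)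
    ... | inj₂ (inj₁ x∈V₁) = Sum.map (p⊆p∪q A₂) (p⊆p∪q B₂) (cover₁ x (x∈p∪q⁺ (inj₂ x∈V₁)))
    ... | inj₂ (inj₂ x∈V₂) = Sum.map (q⊆p∪q A₁ A₂) (q⊆p∪q B₁ B₂) (cover₂ x (x∈p∪q⁺ (inj₂ x∈V₂)))
    disjoint : ∀ x → x ∈ A₁ ∪ A₂ → x ∉ B₁ ∪ B₂
    disjoint x x∈A x∈B with x∈p∪q⁻ A₁ A₂ x∈A | x∈p∪q⁻ B₁ B₂ x∈B
    ... | inj₁ x∈A₁ | inj₁ x∈B₁ = A₁∩B₁=∅ x x∈A₁ x∈B₁
    ... | inj₂ x∈A₂ | inj₂ x∈B₂ = A₂∩B₂=∅ x x∈A₂ x∈B₂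
    ... | inj₁ x∈A₁ | inj₂ x∈B₂ = A₁∩B₁=∅ x x∈A₁ (B₂→B₁ x∈B₂ (A₁⊆G₁ x∈A₁))
    ... | inj₂ x∈A₂ | inj₁ x∈B₁ = A₁∩B₁=∅ x (A₂→A₁ x∈A₂ (B₁⊆G₁ x∈B₁)) x∈B₁

  twoDivision-glued : ∀ {A₁ B₁ A₂ B₂} →
    TwoDivision G (X ∪ V₁) A₁ B₁ → TwoDivision G (X ∪ V₂) A₂ B₂ → AgreeOn X A₁ B₁ A₂ B₂ →
    TwoDivision G ⊤ (A₁ ∪ A₂) (B₁ ∪ B₂)
  twoDivision-glued
    (partition₁@(_ , A₁⊆G₁ , B₁⊆G₁ , A₁∩B₁=∅) , ωA₁ , ωB₁)
    (partition₂@(_ , A₂⊆G₂ , B₂⊆G₂ , A₂∩B₂=∅) , ωA₂ , ωB₂) agree =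
    isPartition-glued partition₁ partition₂ agree ,
    ωLess-glued A₁⊆G₁ A₂⊆G₂ A₁∩B₁=∅ A₂∩B₂=∅ agree ωA₁ ωA₂ ,
    ωLess-glued B₁⊆G₁ B₂⊆G₂ (disjoint-sym A₁∩B₁=∅) (disjoint-sym A₂∩B₂=∅) (agreeOn-swap agree) ωB₁ ωB₂

lemma8 : ∀ {n} (G : Graph n) → MinimallyNon2Divisible G →
    (X V₁ V₂ : Subset n) → IsClique G X →
    (∀ v → v ∉ X → v ∈ V₁ ⊎ v ∈ V₂) →
    (∀ v → v ∈ V₁ → v ∉ X) → (∀ v → v ∈ V₂ → v ∉ X) →
    (∀ v → v ∈ V₁ → v ∉ V₂) →
    (∃[ v ] v ∈ V₁) → (∃[ v ] v ∈ V₂) →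
    (∀ u v → u ∈ V₁ → v ∈ V₂ → ¬ Adj G u v) →
    (A₁ B₁ A₂ B₂ : Subset n) →
    TwoDivision G (X ∪ V₁) A₁ B₁ → TwoDivision G (X ∪ V₂) A₂ B₂ →
    ∃[ x ] (x ∈ X × ¬ (x ∈ A₁ × x ∈ A₂) × ¬ (x ∈ B₁ × x ∈ B₂))
lemma8 G minimal X V₁ V₂ _ outside-X _ _ V₁∩V₂=∅ _ _ no-edge A₁ B₁ A₂ B₂ division₁ division₂
  with agreeOn-or-disagree X A₁ B₁ A₂ B₂
... | inj₂ disagreement = disagreement
... | inj₁ agree = ⊥-elim (¬twoDivision-⊤ G minimal (twoDivision-glued division₁ division₂ agree))
  where open Separation G X V₁ V₂ outside-X V₁∩V₂=∅ no-edge
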